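{- Let $G$ be a bipartite quadriculated torus (i.e. $G=T(n,m,r)$ is simple and bipartite for some integers $n\ge1$, $m\ge2$, $1\le r\le m$). Then the flip graph of $G$ has at least four components consisting of a single vertex.
   Context: Write $Z_k=\{0,1,\dots,k-1\}$. $T(n,m,r)$ is the graph with vertex set $\{v_{i,j}: i\in Z_n, j\in Z_m\}$ (second index modulo $m$) and edges $v_{i,j}v_{i,j+1}$ ($i\in Z_n$, $j\in Z_m$), $v_{i,j}v_{i+1,j}$ ($0\le i\le n-2$, $j\in Z_m$), $v_{n-1,j}v_{0,j+r}$ ($j\in Z_m$), embedded on the torus with faces the 4-cycles $v_{i,j}v_{i,j+1}v_{i+1,j+1}v_{i+1,j}$ ($0\le i\le n-2$) and $v_{n-1,j}v_{n-1,j+1}v_{0,j+r+1}v_{0,j+r}$ ($j\in Z_m$). It is bipartite iff $m$ and $n+r$ are both even. The flip graph has as vertices the perfect matchings of $G$ (equivalently domino tilings), two being adjacent iff their symmetric difference is the boundary of a face. -}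

module Defs where

open import Data.Nat using (ℕ; zero; suc; _+_; _<_; _%_)
open import Data.Nat.Properties using (_<?_)
open import Data.Nat.DivMod using (m%n<n)
open import Data.Fin using (Fin; toℕ; fromℕ<)
open import Data.Bool using (Bool; true; false; _xor_)
open import Data.Product using (Σ; _×_; _,_; proj₁; proj₂; ∃; ∃-syntax)
open import Data.Sum using (_⊎_)
open import Relation.Nullary using (¬_; yes; no)
open import Relation.Binary.PropositionalEquality using (_≡_; _≢_)
open import Function.Bundles using (_⇔_)

Vertex : ℕ → ℕ → Set
Vertex n m = Fin n × Fin m

shift : ∀ {m} → Fin m → ℕ → Fin m
shift {suc m} j k = fromℕ< (m%n<n (toℕ j + k) (suc m))

vstep : ∀ {n m} → ℕ → Fin n → Fin m → Vertex n m
vstep {suc n} r i j with suc (toℕ i) <? suc n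
... | yes p = fromℕ< p , j
... | no _  = Fin.zero , shift j r

-- Edge labels: every edge of T(n,m,r) is labelled exactly once:
--   (i , j , hor) is v_{i,j} v_{i,j+1}
--   (i , j , ver) is v_{i,j} v_{i+1,j}   (i ≤ n-2)   resp.
--                    v_{n-1,j} v_{0,j+r} (i = n-1).
data Kind : Set where
  hor ver : Kind

Edge : ℕ → ℕ → Set
Edge n m = Fin n × Fin m × Kind

ends : ∀ {n m} → ℕ → Edge n m → Vertex n m × Vertex n m
ends r (i , j , hor) = (i , j) , (i , shift j 1)
ends r (i , j , ver) = (i , j) , vstep r i j

Simple : ℕ → ℕ → ℕ → Set
Simple n m r =
  (∀ (e : Edge n m) → proj₁ (ends r e) ≢ proj₂ (ends r e)) ×
  (∀ (e e' : Edge n m) →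
     (ends r e ≡ ends r e' ⊎
      (proj₁ (ends r e) ≡ proj₂ (ends r e') × proj₂ (ends r e) ≡ proj₁ (ends r e'))) →
     e ≡ e')

Bipartite : ℕ → ℕ → ℕ → Set
Bipartite n m r =
  Σ (Vertex n m → Bool) λ c →
    ∀ (e : Edge n m) → c (proj₁ (ends r e)) ≢ c (proj₂ (ends r e))

Incident : ∀ {n m} → ℕ → Vertex n m → Edge n m → Set
Incident r x e = x ≡ proj₁ (ends r e) ⊎ x ≡ proj₂ (ends r e)

EdgeSet : ℕ → ℕ → Set
EdgeSet n m = Edge n m → Bool

PerfectMatching : ∀ {n m} → ℕ → EdgeSet n m → Set
PerfectMatching {n} {m} r M =
  ∀ (x : Vertex n m) →
    Σ (Edge n m) λ e → (M e ≡ true × Incident r x e ×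
            (∀ e' → M e' ≡ true → Incident r x e' → e' ≡ e))

-- Faces are indexed by (i , j) ∈ Z_n × Z_m; face (i , j) is the 4-cycle
-- v_{i,j} v_{i,j+1} w_{j+1} w_j, where w_j = vstep r i j.
-- Its boundary edges:
FaceBoundary : ∀ {n m} → ℕ → Fin n × Fin m → Edge n m → Set
FaceBoundary r (i , j) e =
  e ≡ (i , j , hor) ⊎ e ≡ (i , shift j 1 , ver) ⊎ e ≡ (i , j , ver) ⊎
  e ≡ (proj₁ (vstep r i j) , proj₂ (vstep r i j) , hor)

FlipAdjacent : ∀ {n m} → ℕ → EdgeSet n m → EdgeSet n m → Set
FlipAdjacent {n} {m} r M M' =
  Σ (Fin n × Fin m) λ f →
    ∀ (e : Edge n m) → ((M e xor M' e) ≡ true) ⇔ FaceBoundary r f e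

IsolatedInFlipGraph : ∀ {n m} → ℕ → EdgeSet n m → Set
IsolatedInFlipGraph {n} {m} r M =
  PerfectMatching r M ×
  (∀ (M' : EdgeSet n m) → PerfectMatching r M' → ¬ FlipAdjacent r M M')

{-# OPTIONS --safe #-}
-- Fix a proper 2-colouring. For each direction κ (horizontal or vertical)
-- and colour b, the κ-edges starting at vertices of colour b form a perfect
-- matching: moving one step in direction κ permutes the vertices and swaps
-- the colours. None of these four matchings M admits a flip at a face with
-- corner x. Either M avoids both boundary edges at x, and the flipped matching
-- would contain both; or M contains the κ-edge at x, hence neither the other
-- edge at x nor the κ-edge parallel to it (its start has the other colour),
-- and these two edges, which meet at a vertex, would both be flipped in.
module Submission where

open import Defs
open import Data.Nat using (ℕ; suc; _+_; _∸_; _≤_; _≥_; _<_; NonZero)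
open import Data.Nat.Properties using (_<?_; +-assoc; +-comm; m∸n+n≡m; <-irrefl)
open import Data.Nat.DivMod using (_%_; %-distribˡ-+; m%n%n≡m%n; [m+n]%n≡m%n; m<n⇒m%n≡m)
open import Data.Bool using (Bool; true; false; _∧_; _xor_)
open import Data.Bool.Properties using (¬-not) renaming (_≟_ to _≟ᵇ_)
open import Data.Fin using (Fin; toℕ; fromℕ; inject₁)
open import Data.Fin.Properties using (toℕ-fromℕ<; toℕ-injective; toℕ<n; toℕ-fromℕ; toℕ-inject₁)
open import Data.Fin.Relation.Unary.Top using (view; ‵fromℕ; ‵inject₁)
open import Data.Product using (Σ; _×_; _,_; proj₁; proj₂; uncurry)
open import Data.Sum using (_⊎_; inj₁; inj₂)
open import Data.Empty using (⊥)
open import Function using (_∘_)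
open import Function.Bundles using (Equivalence; _⇔_)
open import Relation.Nullary using (¬_; Dec; yes; no; ⌊_⌋; contradiction)
open import Relation.Binary.Definitions using (DecidableEquality)
open import Relation.Binary.PropositionalEquality
  using (_≡_; _≢_; refl; sym; trans; cong; cong₂; subst; module ≡-Reasoning)

[m%n+k]%n≡[m+k]%n : ∀ a k d .{{_ : NonZero d}} → (a % d + k) % d ≡ (a + k) % d
[m%n+k]%n≡[m+k]%n a k d = begin
  (a % d + k) % d           ≡⟨ %-distribˡ-+ (a % d) k d ⟩
  (a % d % d + k % d) % d   ≡⟨ cong (λ z → (z + k % d) % d) (m%n%n≡m%n a d) ⟩
  (a % d + k % d) % d       ≡⟨ %-distribˡ-+ a k d ⟨
  (a + k) % d               ∎
  where open ≡-Reasoning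

toℕ-shift : ∀ {m} (j : Fin (suc m)) k → toℕ (shift j k) ≡ (toℕ j + k) % suc m
toℕ-shift {m} j k = toℕ-fromℕ< _

shift-shift-cancel : ∀ {m} (j : Fin (suc m)) a b → a + b ≡ suc m → shift (shift j a) b ≡ j
shift-shift-cancel {m} j a b a+b≡m = toℕ-injective (begin
  toℕ (shift (shift j a) b)         ≡⟨ toℕ-shift (shift j a) b ⟩
  (toℕ (shift j a) + b) % suc m     ≡⟨ cong (λ z → (z + b) % suc m) (toℕ-shift j a) ⟩
  ((toℕ j + a) % suc m + b) % suc m ≡⟨ [m%n+k]%n≡[m+k]%n (toℕ j + a) b (suc m) ⟩
  (toℕ j + a + b) % suc m           ≡⟨ cong (_% suc m) (trans (+-assoc (toℕ j) a b) (cong (toℕ j +_) a+b≡m)) ⟩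
  (toℕ j + suc m) % suc m           ≡⟨ [m+n]%n≡m%n (toℕ j) (suc m) ⟩
  toℕ j % suc m                     ≡⟨ m<n⇒m%n≡m (toℕ<n j) ⟩
  toℕ j                             ∎)
  where open ≡-Reasoning

module _ {n m : ℕ} (r : ℕ) where

  vstep-fromℕ : ∀ j → vstep {suc n} {suc m} r (fromℕ n) j ≡ (Fin.zero , shift j r)
  vstep-fromℕ j with suc (toℕ (fromℕ n)) <? suc n
  ... | yes n<n = contradiction n<n (<-irrefl (cong suc (toℕ-fromℕ n)))
  ... | no _    = refl

  vstep-inject₁ : ∀ (i : Fin n) j → vstep {suc n} {suc m} r (inject₁ i) j ≡ (Fin.suc i , j)
  vstep-inject₁ i j with suc (toℕ (inject₁ i)) <? suc n
  ... | yes i+1<n = cong (_, j) (toℕ-injective (trans (toℕ-fromℕ< i+1<n) (cong suc (toℕ-inject₁ i))))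
  ... | no i+1≮n  = contradiction (subst (_< suc n) (cong suc (sym (toℕ-inject₁ i))) (toℕ<n (Fin.suc i))) i+1≮n

  vstep⁻¹ : Vertex (suc n) (suc m) → Vertex (suc n) (suc m)
  vstep⁻¹ (Fin.zero  , j) = fromℕ n , shift j (suc m ∸ r)
  vstep⁻¹ (Fin.suc i , j) = inject₁ i , j

  module _ (r≤m : r ≤ suc m) where

    vstep-vstep⁻¹ : ∀ x → uncurry (vstep r) (vstep⁻¹ x) ≡ x
    vstep-vstep⁻¹ (Fin.zero  , j) =
      trans (vstep-fromℕ _) (cong (Fin.zero ,_) (shift-shift-cancel j (suc m ∸ r) r (m∸n+n≡m r≤m)))
    vstep-vstep⁻¹ (Fin.suc i , j) = vstep-inject₁ i j

    vstep⁻¹-vstep : ∀ i j → vstep⁻¹ (vstep r i j) ≡ (i , j)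
    vstep⁻¹-vstep i j with view i
    ... | ‵fromℕ = begin
      vstep⁻¹ (vstep r (fromℕ n) j)              ≡⟨ cong vstep⁻¹ (vstep-fromℕ j) ⟩
      fromℕ n , shift (shift j r) (suc m ∸ r)    ≡⟨ cong (fromℕ n ,_) (shift-shift-cancel j r (suc m ∸ r) r+[m∸r]≡m) ⟩
      fromℕ n , j                                ∎
      where
      open ≡-Reasoning
      r+[m∸r]≡m : r + (suc m ∸ r) ≡ suc m
      r+[m∸r]≡m = trans (+-comm r _) (m∸n+n≡m r≤m)
    ... | ‵inject₁ i′ = cong vstep⁻¹ (vstep-inject₁ i′ j)

two-colours : ∀ {a b c : Bool} → a ≢ c → b ≢ c → a ≡ b
two-colours a≢c b≢c = trans (¬-not a≢c) (sym (¬-not b≢c))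

other : Kind → Kind
other hor = ver
other ver = hor

other-≢ : ∀ κ → other κ ≢ κ
other-≢ hor ()
other-≢ ver ()

_≟ᴷ_ : DecidableEquality Kind
hor ≟ᴷ hor = yes refl
ver ≟ᴷ ver = yes refl
hor ≟ᴷ ver = no λ ()
ver ≟ᴷ hor = no λ ()

perfect-unique : ∀ {n m r} {M : EdgeSet n m} → PerfectMatching r M → ∀ {y e e′} →
  M e ≡ true → M e′ ≡ true → Incident r y e → Incident r y e′ → e ≡ e′
perfect-unique pm {y} e∈M e′∈M y~e y~e′ with pm y
... | _ , _ , _ , unique = trans (unique _ e∈M y~e) (sym (unique _ e′∈M y~e′))

flip-boundary : ∀ {n m r} {M M′ : EdgeSet n m} {f} →
  (∀ e → ((M e xor M′ e) ≡ true) ⇔ FaceBoundary r f e) →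
  ∀ {e} → FaceBoundary r f e → M e ≢ true → M′ e ≡ true
flip-boundary {M = M} iff {e} e∈∂f e∉M with M e | Equivalence.from (iff e) e∈∂f
... | true  | _     = contradiction refl e∉M
... | false | e∈M′  = e∈M′

module Torus {n m : ℕ} (r : ℕ) where

  V : Set
  V = Vertex (suc n) (suc m)

  E : Set
  E = Edge (suc n) (suc m)

  step : Kind → V → V
  step hor (i , j) = i , shift j 1
  step ver (i , j) = vstep r i j

  edge : V → Kind → E
  edge x κ = proj₁ x , proj₂ x , κ

  source : E → V
  source e = proj₁ e , proj₁ (proj₂ e)

  kind : E → Kind
  kind e = proj₂ (proj₂ e)

  target : E → V
  target e = step (kind e) (source e)

  incident-ends : ∀ {y} e → Incident r y e → y ≡ source e ⊎ y ≡ target e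
  incident-ends (i , j , hor) y~e = y~e
  incident-ends (i , j , ver) y~e = y~e

  ends-incident : ∀ {y} e → y ≡ source e ⊎ y ≡ target e → Incident r y e
  ends-incident (i , j , hor) y∈e = y∈e
  ends-incident (i , j , ver) y∈e = y∈e

  source-target-≢ : ∀ {A : Set} (c : V → A) →
    (∀ e → c (proj₁ (ends r e)) ≢ c (proj₂ (ends r e))) → ∀ e → c (source e) ≢ c (target e)
  source-target-≢ c proper (i , j , hor) = proper (i , j , hor)
  source-target-≢ c proper (i , j , ver) = proper (i , j , ver)

  face-corner : ∀ x κ → FaceBoundary r x (edge x κ)
  face-corner (i , j) hor = inj₁ refl
  face-corner (i , j) ver = inj₂ (inj₂ (inj₁ refl))

  face-opposite : ∀ x κ → FaceBoundary r x (edge (step (other κ) x) κ)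
  face-opposite (i , j) hor = inj₂ (inj₂ (inj₂ refl))
  face-opposite (i , j) ver = inj₂ (inj₁ refl)

  step⁻¹ : Kind → V → V
  step⁻¹ hor (i , j) = i , shift j m
  step⁻¹ ver x       = vstep⁻¹ r x

  module _ (r≤m : r ≤ suc m) where

    step-step⁻¹ : ∀ κ x → step κ (step⁻¹ κ x) ≡ x
    step-step⁻¹ hor (i , j) = cong (i ,_) (shift-shift-cancel j m 1 (+-comm m 1))
    step-step⁻¹ ver x       = vstep-vstep⁻¹ r r≤m x

    step⁻¹-step : ∀ κ x → step⁻¹ κ (step κ x) ≡ x
    step⁻¹-step hor (i , j) = cong (i ,_) (shift-shift-cancel j 1 m refl)
    step⁻¹-step ver (i , j) = vstep⁻¹-vstep r r≤m i j

    module Matchings (col : V → Bool)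
                     (proper : ∀ e → col (proj₁ (ends r e)) ≢ col (proj₂ (ends r e))) where

      matching : Kind → Bool → EdgeSet (suc n) (suc m)
      matching κ b e = ⌊ kind e ≟ᴷ κ ⌋ ∧ ⌊ col (source e) ≟ᵇ b ⌋

      matching-true : ∀ {κ b} e → matching κ b e ≡ true → kind e ≡ κ × col (source e) ≡ b
      matching-true {κ} {b} e e∈M with kind e ≟ᴷ κ | col (source e) ≟ᵇ b
      ... | yes κ≡ | yes b≡ = κ≡ , b≡

      matching-edge : ∀ {x b} κ → col x ≡ b → matching κ b (edge x κ) ≡ true
      matching-edge {x} {b} κ cx≡b with κ ≟ᴷ κ | col x ≟ᵇ b
      ... | yes _ | yes _ = refl
      ... | no κ≢κ | _    = contradiction refl κ≢κ
      ... | _ | no cx≢b   = contradiction cx≡b cx≢b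

      col-step : ∀ κ x → col (step κ x) ≢ col x
      col-step κ x = source-target-≢ col proper (edge x κ) ∘ sym

      matching-perfect : ∀ κ b → PerfectMatching r (matching κ b)
      matching-perfect κ b y with col y ≟ᵇ b
      ... | yes cy≡b = edge y κ , matching-edge κ cy≡b , ends-incident (edge y κ) (inj₁ refl) , unique
        where
        unique : ∀ e → matching κ b e ≡ true → Incident r y e → e ≡ edge y κ
        unique e e∈M y~e with matching-true e e∈M | incident-ends e y~e
        ... | refl , _      | inj₁ y≡src = cong (λ z → edge z (kind e)) (sym y≡src)
        ... | refl , csrc≡b | inj₂ y≡tgt =
          contradiction (trans (cong col (sym y≡tgt)) (trans cy≡b (sym csrc≡b))) (col-step κ (source e))
      ... | no cy≢b =
        edge x κ , matching-edge κ cx≡b , ends-incident (edge x κ) (inj₂ (sym (step-step⁻¹ κ y))) , unique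
        where
        x = step⁻¹ κ y
        cx≡b : col x ≡ b
        cx≡b = two-colours (λ cx≡cy → col-step κ x (trans (cong col (step-step⁻¹ κ y)) (sym cx≡cy))) (cy≢b ∘ sym)
        unique : ∀ e → matching κ b e ≡ true → Incident r y e → e ≡ edge x κ
        unique e e∈M y~e with matching-true e e∈M | incident-ends e y~e
        ... | refl , csrc≡b | inj₁ y≡src = contradiction (trans (cong col y≡src) csrc≡b) cy≢b
        ... | refl , _      | inj₂ y≡tgt =
          cong (λ z → edge z κ) (trans (sym (step⁻¹-step κ (source e))) (cong (step⁻¹ κ) (sym y≡tgt)))

      other-kind-∉ : ∀ {κ b} e → kind e ≢ κ → matching κ b e ≢ true
      other-kind-∉ e κe≢κ = κe≢κ ∘ proj₁ ∘ matching-true e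

      other-colour-∉ : ∀ {κ b} e → col (source e) ≢ b → matching κ b e ≢ true
      other-colour-∉ e c≢b = c≢b ∘ proj₂ ∘ matching-true e

      matching-isolated : ∀ κ b → IsolatedInFlipGraph r (matching κ b)
      matching-isolated κ b = matching-perfect κ b , no-flip
        where
        no-flip : ∀ M′ → PerfectMatching r M′ → ¬ FlipAdjacent r (matching κ b) M′
        no-flip M′ pm′ (x , iff) = clash (col x ≟ᵇ b)
          where
          in-M′ : ∀ {e} → FaceBoundary r x e → matching κ b e ≢ true → M′ e ≡ true
          in-M′ = flip-boundary {M = matching κ b} iff

          same-kind : ∀ {y e e′} → M′ e ≡ true → M′ e′ ≡ true →
            Incident r y e → Incident r y e′ → kind e ≡ kind e′
          same-kind e∈M′ e′∈M′ y~e y~e′ = cong kind (perfect-unique pm′ e∈M′ e′∈M′ y~e y~e′)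

          clash : Dec (col x ≡ b) → ⊥
          clash (no cx≢b) = other-≢ κ (sym (same-kind
            (in-M′ (face-corner x κ) (other-colour-∉ (edge x κ) cx≢b))
            (in-M′ (face-corner x (other κ)) (other-kind-∉ (edge x (other κ)) (other-≢ κ)))
            (ends-incident (edge x κ) (inj₁ refl))
            (ends-incident (edge x (other κ)) (inj₁ refl))))
          clash (yes cx≡b) = other-≢ κ (same-kind
            (in-M′ (face-corner x (other κ)) (other-kind-∉ (edge x (other κ)) (other-≢ κ)))
            (in-M′ (face-opposite x κ) (other-colour-∉ (edge y κ) cy≢b))
            (ends-incident (edge x (other κ)) (inj₂ refl))
            (ends-incident (edge y κ) (inj₁ refl)))
            where
            y = step (other κ) x
            cy≢b : col y ≢ b
            cy≢b cy≡b = col-step (other κ) x (trans cy≡b (sym cx≡b))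

      matching-injective : ∀ {κ b κ′ b′} →
        (∀ e → matching κ b e ≡ matching κ′ b′ e) → (κ , b) ≡ (κ′ , b′)
      matching-injective {κ} {b} same with matching-perfect κ b (Fin.zero , Fin.zero)
      ... | e , e∈M , _ with matching-true e e∈M | matching-true e (trans (sym (same e)) e∈M)
      ... | κe≡κ , c≡b | κe≡κ′ , c≡b′ = cong₂ _,_ (trans (sym κe≡κ) κe≡κ′) (trans (sym c≡b) c≡b′)

code : Fin 4 → Kind × Bool
code Fin.zero                               = hor , true
code (Fin.suc Fin.zero)                     = hor , false
code (Fin.suc (Fin.suc Fin.zero))           = ver , true
code (Fin.suc (Fin.suc (Fin.suc Fin.zero))) = ver , false

decode : Kind × Bool → Fin 4
decode (hor , true)  = Fin.zero
decode (hor , false) = Fin.suc Fin.zero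
decode (ver , true)  = Fin.suc (Fin.suc Fin.zero)
decode (ver , false) = Fin.suc (Fin.suc (Fin.suc Fin.zero))

decode-code : ∀ k → decode (code k) ≡ k
decode-code Fin.zero                               = refl
decode-code (Fin.suc Fin.zero)                     = refl
decode-code (Fin.suc (Fin.suc Fin.zero))           = refl
decode-code (Fin.suc (Fin.suc (Fin.suc Fin.zero))) = refl

code-injective : ∀ {k l} → code k ≡ code l → k ≡ l
code-injective {k} {l} eq = trans (sym (decode-code k)) (trans (cong decode eq) (decode-code l))

theorem4p5 : (n m r : ℕ) → n ≥ 1 → m ≥ 2 → 1 ≤ r → r ≤ m →
    Simple n m r → Bipartite n m r →
    Σ (Fin 4 → EdgeSet n m) λ M →
      (∀ k → IsolatedInFlipGraph r (M k)) ×
      (∀ k l → k ≢ l → ¬ (∀ e → M k e ≡ M l e))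
theorem4p5 (suc n) (suc m) r _ _ _ r≤m _ (col , proper) =
    uncurry matching ∘ code
  , (λ k → uncurry matching-isolated (code k))
  , (λ k l k≢l same → k≢l (code-injective (matching-injective same)))
  where open Torus.Matchings r r≤m col proper
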